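{- Let $k\ge2$ and let $\Gamma$ and $\Gamma'$ be vertex-disjoint finite simple $(2k)$-regular graphs admitting self-reverse distance magic labelings $\ell$ and $\ell'$, respectively; let $n=|V(\Gamma)|$. Let $d=2d_0\ge4$ be even and let $C=(u_0,\ldots,u_{d-1})$, $C'=(v_0,\ldots,v_{d-1})$ be cyclets of length $d$ in $\Gamma$ and $\Gamma'$, respectively, such that: (a) the bipartition $\{A',B'\}$ of $V(\Gamma')$ with $A'=\{v\colon\ell'(v)\ge0\}$, $B'=\{v\colon\ell'(v)<0\}$ is balanced; (b) $C'$ is alternating with respect to $\ell'$; (c) $\ell(u_{i-1})+\ell(u_{i+1})=\ell'(v_{i-1})+\ell'(v_{i+1})$ for each $i\in\mathbb{Z}_d$. Suppose moreover that one of the following holds (indices mod $d$): (i) $u_{i+d_0}=u_i^\ell$ and $v_{i+d_0}=v_i^{\ell'}$ for all $i\in\mathbb{Z}_d$; or (ii) $u_{i+d_0}=u_{d_0-1-i}^\ell$ and $v_{i+d_0}=v_{d_0-1-i}^{\ell'}$ for all $i\in\mathbb{Z}_d$. Define $\tilde\ell$ on $V(\Gamma\oplus^C_{C'}\Gamma')=V(\Gamma)\cup V(\Gamma')$ by $\tilde\ell(w)=\ell(w)$ for $w\in V(\Gamma)$, $\tilde\ell(w)=\ell'(w)+n$ for $w\in A'$, and $\tilde\ell(w)=\ell'(w)-n$ for $w\in B'$. Then $\tilde\ell$ is a self-reverse distance magic labeling of $\Gamma\oplus^C_{C'}\Gamma'$.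
   Context: For a positive integer $n$, $\mathcal{I}_n=\{1-n,3-n,\ldots,n-1\}$. For a regular graph $\Gamma$ of order $n$, a distance magic labeling is a bijection $\ell\colon V(\Gamma)\to\mathcal{I}_n$ such that for every vertex the sum of the labels of its neighbors equals $0$. For $v\in V(\Gamma)$, $v^\ell$ is the unique vertex with $\ell(v)+\ell(v^\ell)=0$; $\ell$ is self-reverse if for all vertices $u,v$: $u\sim v$ if and only if $u^\ell\sim v^\ell$. A cyclet of length $d$ is a sequence $(w_0,\ldots,w_{d-1})$ of pairwise distinct vertices with $w_iw_{i+1}$ an edge for each $i\in\mathbb{Z}_d$; these $d$ edges are the edges of the cyclet. The merge $\Gamma\oplus^C_{C'}\Gamma'$ with respect to cyclets $C=(u_0,\ldots,u_{d-1})$, $C'=(v_0,\ldots,v_{d-1})$ is obtained from the disjoint union of $\Gamma$ and $\Gamma'$ by deleting the edges of $C$ and of $C'$ (keeping all vertices and other edges) and adding the edges $u_iv_{i+1}$ and $v_iu_{i+1}$ for each $i\in\mathbb{Z}_d$. Given a bipartition $\{A,B\}$ of the vertex set, an edge is a link if its endvertices lie in different parts and a non-link otherwise; the bipartition is balanced if every vertex has equally many neighbors in $A$ and in $B$; an even-length cyclet is alternating if its edges alternate between links and non-links. "With respect to $\ell'$" refers to the bipartition $\{A',B'\}$. -}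

module Defs where

open import Data.Nat as ℕ using (ℕ; zero; suc; _∸_; _%_)
open import Data.Nat.DivMod using (m%n<n)
open import Data.Integer as ℤ using (ℤ; +_; 0ℤ; _+_; _-_; _≤?_; _<_; _≤_)
open import Data.Fin as Fin using (Fin; toℕ; fromℕ<; splitAt; _↑ˡ_; _↑ʳ_)
open import Data.Bool using (Bool; true; false; _∧_; _∨_; not; if_then_else_; _xor_)
open import Data.Sum using (_⊎_; inj₁; inj₂)
open import Data.Product using (Σ; ∃; _×_; _,_)
open import Relation.Nullary using (does)
open import Relation.Binary.PropositionalEquality using (_≡_)
open import Function using (_∘_)

Adj : ℕ → Set
Adj m = Fin m → Fin m → Bool

IsSimple : ∀ {m} → Adj m → Set
IsSimple {m} adj = (∀ a b → adj a b ≡ adj b a) × (∀ a → adj a a ≡ false)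

sumℤ : ∀ {m} → (Fin m → ℤ) → ℤ
sumℤ {zero} f = 0ℤ
sumℤ {suc m} f = f Fin.zero + sumℤ (f ∘ Fin.suc)

count : ∀ {m} → (Fin m → Bool) → ℕ
count {zero} p = 0
count {suc m} p = (if p Fin.zero then 1 else 0) ℕ.+ count (p ∘ Fin.suc)

anyFin : ∀ {m} → (Fin m → Bool) → Bool
anyFin {zero} p = false
anyFin {suc m} p = p Fin.zero ∨ anyFin (p ∘ Fin.suc)

IsRegular : ∀ {m} → Adj m → ℕ → Set
IsRegular adj r = ∀ v → count (adj v) ≡ r

InI : ℕ → ℤ → Set
InI m x = Σ ℕ λ j → (j ℕ.< m) × (x ≡ (+ (2 ℕ.* j ℕ.+ 1)) - (+ m))

IsBijI : ∀ m → (Fin m → ℤ) → Set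
IsBijI m ℓ = (∀ v → InI m (ℓ v))
           × (∀ u v → ℓ u ≡ ℓ v → u ≡ v)
           × (∀ x → InI m x → ∃ λ v → ℓ v ≡ x)

IsDistanceMagic : ∀ {m} → Adj m → (Fin m → ℤ) → Set
IsDistanceMagic {m} adj ℓ =
  IsBijI m ℓ × (∀ v → sumℤ (λ u → if adj v u then ℓ u else 0ℤ) ≡ 0ℤ)

-- w is v^ℓ  (the unique vertex with ℓ(v) + ℓ(w) = 0)
IsRev : ∀ {m} → (Fin m → ℤ) → Fin m → Fin m → Set
IsRev ℓ v w = ℓ v + ℓ w ≡ 0ℤ

IsSelfReverse : ∀ {m} → Adj m → (Fin m → ℤ) → Set
IsSelfReverse adj ℓ = ∀ u v u* v* → IsRev ℓ u u* → IsRev ℓ v v* → adj u v ≡ adj u* v*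

IsSelfReverseDML : ∀ {m} → Adj m → (Fin m → ℤ) → Set
IsSelfReverseDML adj ℓ = IsDistanceMagic adj ℓ × IsSelfReverse adj ℓ

addF : ∀ {d} → Fin d → ℕ → Fin d
addF {suc d} i k = fromℕ< (m%n<n (toℕ i ℕ.+ k) (suc d))

negF : ∀ {d} → Fin d → Fin d
negF {suc d} i = fromℕ< (m%n<n (suc d ∸ toℕ i) (suc d))

sucF : ∀ {d} → Fin d → Fin d
sucF i = addF i 1

predF : ∀ {d} → Fin d → Fin d
predF {d} i = addF i (d ∸ 1)

IsCyclet : ∀ {m d} → Adj m → (Fin d → Fin m) → Set
IsCyclet adj w = (∀ i j → w i ≡ w j → i ≡ j) × (∀ i → adj (w i) (w (sucF i)) ≡ true)

eqB : ∀ {m} → Fin m → Fin m → Bool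
eqB a b = does (a Fin.≟ b)

cycEdge : ∀ {m d} → (Fin d → Fin m) → Fin m → Fin m → Bool
cycEdge w a b = anyFin λ i →
  (eqB (w i) a ∧ eqB (w (sucF i)) b) ∨ (eqB (w i) b ∧ eqB (w (sucF i)) a)

crossEdge : ∀ {n n' d} → (Fin d → Fin n) → (Fin d → Fin n') → Fin n → Fin n' → Bool
crossEdge u v a b = anyFin λ i →
  (eqB (u i) a ∧ eqB (v (sucF i)) b) ∨ (eqB (v i) b ∧ eqB (u (sucF i)) a)

merge : ∀ {n n' d} → Adj n → Adj n' → (Fin d → Fin n) → (Fin d → Fin n') → Adj (n ℕ.+ n')
merge {n} adj adj' u v x y with splitAt n x | splitAt n y
... | inj₁ a | inj₁ b = adj a b ∧ not (cycEdge u a b)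
... | inj₂ a | inj₂ b = adj' a b ∧ not (cycEdge v a b)
... | inj₁ a | inj₂ b = crossEdge u v a b
... | inj₂ a | inj₁ b = crossEdge u v b a

inA : ℤ → Bool
inA x = does (0ℤ ≤? x)

IsBalanced : ∀ {m} → Adj m → (Fin m → Bool) → Set
IsBalanced adj side =
  ∀ v → count (λ u → adj v u ∧ side u) ≡ count (λ u → adj v u ∧ not (side u))

isLink : ∀ {m} → (Fin m → Bool) → Fin m → Fin m → Bool
isLink side a b = side a xor side b

IsAlternating : ∀ {m d} → (Fin m → Bool) → (Fin d → Fin m) → Set
IsAlternating side w =
  ∀ i → isLink side (w (sucF i)) (w (sucF (sucF i))) ≡ not (isLink side (w i) (w (sucF i)))

mergeLabel : ∀ n {n'} → (Fin n → ℤ) → (Fin n' → ℤ) → Fin (n ℕ.+ n') → ℤ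
mergeLabel n ℓ ℓ' x with splitAt n x
... | inj₁ a = ℓ a
... | inj₂ b = if inA (ℓ' b) then ℓ' b + + n else ℓ' b - + n

-- The sides A', B' of a balanced bipartition of a regular graph have equal size (double
-- count the signed edge sum), so n' is even, and the labels of Γ together with the labels of
-- A' shifted up by n and those of B' shifted down by n fill I_{n+n'} exactly.  At u_i the
-- merge trades the neighbours u_{i±1} for v_{i±1}; alternation puts v_{i-1} and v_{i+1} on
-- opposite sides, so their shifts cancel and (c) keeps the neighbour sum 0.  At a vertex of Γ'
-- the shifts add up to n·(#A'-neighbours − #B'-neighbours) = 0 by balance.  Finally, the
-- reversal v ↦ v^ℓ acts on the positions of both cyclets as a translation (i) or a reflection
-- (ii) of ℤ_d; either maps consecutive positions to consecutive positions, so it maps the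
-- deleted cyclet edges and the added cross edges onto themselves.
module Submission where

open import Defs
open import Data.Bool using (Bool; true; false; not; _∧_; _∨_; _xor_; if_then_else_)
open import Data.Bool.Properties using (∨-zeroʳ; ⇔→≡; ¬-not)
open import Data.Empty using (⊥-elim)
open import Data.Fin as Fin using (Fin; toℕ; fromℕ<; _↑ˡ_; _↑ʳ_; splitAt)
open import Data.Fin.Properties
  using (nonZeroIndex; toℕ-fromℕ<; toℕ-injective; toℕ<n; any?; splitAt-↑ˡ; splitAt-↑ʳ; splitAt⁻¹-↑ˡ; splitAt⁻¹-↑ʳ)
open import Data.Integer as ℤ using (ℤ; +_; 0ℤ; 1ℤ; _+_; _-_; -_; _⊖_)
import Data.Integer.Properties as ℤP
open import Data.Integer.Tactic.RingSolver using (solve-∀)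
open import Data.Nat as ℕ using (ℕ; zero; suc; _≤_; _<_; _*_; _∸_; _%_; _<?_; NonZero; z≤n; s≤s; z<s)
import Data.Nat.Properties as ℕP
open import Data.Nat.DivMod using (m%n<n; %-distribˡ-+; m%n%n≡m%n; [m+kn]%n≡m%n; m<n⇒m%n≡m; n%n≡0)
import Data.Nat.Tactic.RingSolver as ℕSolver
open import Data.Product as Prod using (∃; _×_; _,_; proj₁; proj₂)
open import Data.Sum as Sum using (_⊎_; inj₁; inj₂)
open import Function using (id; _∘_)
open import Function.Bundles using (mk⇔)
open import Relation.Binary.PropositionalEquality
open import Relation.Nullary using (yes; no)
open import Relation.Nullary.Decidable using (dec-true; dec-false)
open import Algebra.Properties.AbelianGroup ℤP.+-0-abelianGroup using (inverseʳ-unique; ∙-cancelʳ)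
open import Algebra.Properties.CommutativeSemigroup ℤP.+-commutativeSemigroup using (interchange)
open ≡-Reasoning

-- Positions on a cyclet: ℤ_d as Fin d under addF, negF, sucF, predF

[m%d+n]%d≡[m+n]%d : ∀ m n d .{{_ : NonZero d}} → (m % d ℕ.+ n) % d ≡ (m ℕ.+ n) % d
[m%d+n]%d≡[m+n]%d m n d = begin
  (m % d ℕ.+ n) % d          ≡⟨ %-distribˡ-+ (m % d) n d ⟩
  (m % d % d ℕ.+ n % d) % d  ≡⟨ cong (λ x → (x ℕ.+ n % d) % d) (m%n%n≡m%n m d) ⟩
  (m % d ℕ.+ n % d) % d      ≡⟨ %-distribˡ-+ m n d ⟨
  (m ℕ.+ n) % d              ∎

module _ {D : ℕ} where

  private
    d : ℕ
    d = suc D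

  toℕ-addF : (i : Fin d) (k : ℕ) → toℕ (addF i k) ≡ (toℕ i ℕ.+ k) % d
  toℕ-addF i k = toℕ-fromℕ< (m%n<n (toℕ i ℕ.+ k) d)

  addF-zero-toℕ : (i : Fin d) → addF Fin.zero (toℕ i) ≡ i
  addF-zero-toℕ i = toℕ-injective (trans (toℕ-addF Fin.zero (toℕ i)) (m<n⇒m%n≡m (toℕ<n i)))

  addF-addF : (i : Fin d) (k l : ℕ) → addF (addF i k) l ≡ addF i (k ℕ.+ l)
  addF-addF i k l = toℕ-injective (begin
    toℕ (addF (addF i k) l)         ≡⟨ toℕ-addF (addF i k) l ⟩
    (toℕ (addF i k) ℕ.+ l) % d      ≡⟨ cong (λ x → (x ℕ.+ l) % d) (toℕ-addF i k) ⟩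
    ((toℕ i ℕ.+ k) % d ℕ.+ l) % d   ≡⟨ [m%d+n]%d≡[m+n]%d (toℕ i ℕ.+ k) l d ⟩
    (toℕ i ℕ.+ k ℕ.+ l) % d         ≡⟨ cong (_% d) (ℕP.+-assoc (toℕ i) k l) ⟩
    (toℕ i ℕ.+ (k ℕ.+ l)) % d       ≡⟨ toℕ-addF i (k ℕ.+ l) ⟨
    toℕ (addF i (k ℕ.+ l))          ∎)

  addF-periods : (i : Fin d) (q : ℕ) → addF i (q * d) ≡ i
  addF-periods i q = toℕ-injective (begin
    toℕ (addF i (q * d))     ≡⟨ toℕ-addF i (q * d) ⟩
    (toℕ i ℕ.+ q * d) % d    ≡⟨ [m+kn]%n≡m%n (toℕ i) q d ⟩
    toℕ i % d                ≡⟨ m<n⇒m%n≡m (toℕ<n i) ⟩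
    toℕ i                    ∎)

  addF-period : (i : Fin d) → addF i d ≡ i
  addF-period i = trans (cong (addF i) (sym (ℕP.*-identityˡ d))) (addF-periods i 1)

  -- Adding k * D after k adds a multiple of d.
  addF-cancelʳ : {i j : Fin d} (k : ℕ) → addF i k ≡ addF j k → i ≡ j
  addF-cancelʳ {i} {j} k eq = begin
    i                          ≡⟨ addF-periods i k ⟨
    addF i (k * d)             ≡⟨ cong (addF i) (ℕP.*-suc k D) ⟩
    addF i (k ℕ.+ k * D)       ≡⟨ addF-addF i k (k * D) ⟨
    addF (addF i k) (k * D)    ≡⟨ cong (λ x → addF x (k * D)) eq ⟩
    addF (addF j k) (k * D)    ≡⟨ addF-addF j k (k * D) ⟩
    addF j (k ℕ.+ k * D)       ≡⟨ cong (addF j) (ℕP.*-suc k D) ⟨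
    addF j (k * d)             ≡⟨ addF-periods j k ⟩
    j                          ∎

  addF-comm : (i j : Fin d) → addF i (toℕ j) ≡ addF j (toℕ i)
  addF-comm i j = begin
    addF i (toℕ j)                         ≡⟨ cong (λ x → addF x (toℕ j)) (addF-zero-toℕ i) ⟨
    addF (addF Fin.zero (toℕ i)) (toℕ j)   ≡⟨ addF-addF Fin.zero (toℕ i) (toℕ j) ⟩
    addF Fin.zero (toℕ i ℕ.+ toℕ j)        ≡⟨ cong (addF Fin.zero) (ℕP.+-comm (toℕ i) (toℕ j)) ⟩
    addF Fin.zero (toℕ j ℕ.+ toℕ i)        ≡⟨ addF-addF Fin.zero (toℕ j) (toℕ i) ⟨
    addF (addF Fin.zero (toℕ j)) (toℕ i)   ≡⟨ cong (λ x → addF x (toℕ i)) (addF-zero-toℕ j) ⟩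
    addF j (toℕ i)                         ∎

  addF-sucF : (i : Fin d) (k : ℕ) → addF (sucF i) k ≡ sucF (addF i k)
  addF-sucF i k = begin
    addF (addF i 1) k    ≡⟨ addF-addF i 1 k ⟩
    addF i (1 ℕ.+ k)     ≡⟨ cong (addF i) (ℕP.+-comm 1 k) ⟩
    addF i (k ℕ.+ 1)     ≡⟨ addF-addF i k 1 ⟨
    addF (addF i k) 1    ∎

  sucF-predF : (i : Fin d) → sucF (predF i) ≡ i
  sucF-predF i = begin
    addF (addF i D) 1    ≡⟨ addF-addF i D 1 ⟩
    addF i (D ℕ.+ 1)     ≡⟨ cong (addF i) (ℕP.+-comm D 1) ⟩
    addF i d             ≡⟨ addF-period i ⟩
    i                    ∎

  predF-sucF : (i : Fin d) → predF (sucF i) ≡ i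
  predF-sucF i = trans (addF-addF i 1 D) (addF-period i)

  sucF≢predF : 2 < d → (i : Fin d) → sucF i ≢ predF i
  sucF≢predF 2<d i eq = 2≢0 (trans (sym (toℕ-fromℕ< 2<d)) (cong toℕ (addF-cancelʳ (toℕ i) two+i≡0+i)))
    where
    two : Fin d
    two = fromℕ< 2<d
    2≢0 : 2 ≢ 0
    2≢0 ()
    two+i≡0+i : addF two (toℕ i) ≡ addF Fin.zero (toℕ i)
    two+i≡0+i = begin
      addF two (toℕ i)         ≡⟨ addF-comm two i ⟩
      addF i (toℕ two)         ≡⟨ cong (addF i) (toℕ-fromℕ< 2<d) ⟩
      addF i 2                 ≡⟨ addF-addF i 1 1 ⟨
      addF (sucF i) 1          ≡⟨ cong (λ j → addF j 1) eq ⟩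
      sucF (predF i)           ≡⟨ sucF-predF i ⟩
      i                        ≡⟨ addF-zero-toℕ i ⟨
      addF Fin.zero (toℕ i)    ∎

  addF-negF : (i : Fin d) (k : ℕ) → addF (addF (negF i) k) (toℕ i) ≡ addF Fin.zero k
  addF-negF i k = begin
    addF (addF (negF i) k) (toℕ i)    ≡⟨ addF-addF (negF i) k (toℕ i) ⟩
    addF (negF i) (k ℕ.+ toℕ i)       ≡⟨ cong (addF (negF i)) (ℕP.+-comm k (toℕ i)) ⟩
    addF (negF i) (toℕ i ℕ.+ k)       ≡⟨ addF-addF (negF i) (toℕ i) k ⟨
    addF (addF (negF i) (toℕ i)) k    ≡⟨ cong (λ j → addF j k) negF+i≡0 ⟩
    addF Fin.zero k                   ∎
    where
    negF+i≡0 : addF (negF i) (toℕ i) ≡ Fin.zero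
    negF+i≡0 = toℕ-injective (begin
      toℕ (addF (negF i) (toℕ i))       ≡⟨ toℕ-addF (negF i) (toℕ i) ⟩
      (toℕ (negF i) ℕ.+ toℕ i) % d
        ≡⟨ cong (λ x → (x ℕ.+ toℕ i) % d) (toℕ-fromℕ< (m%n<n (d ∸ toℕ i) d)) ⟩
      ((d ∸ toℕ i) % d ℕ.+ toℕ i) % d   ≡⟨ [m%d+n]%d≡[m+n]%d (d ∸ toℕ i) (toℕ i) d ⟩
      (d ∸ toℕ i ℕ.+ toℕ i) % d         ≡⟨ cong (_% d) (ℕP.m∸n+n≡m (ℕP.<⇒≤ (toℕ<n i))) ⟩
      d % d                             ≡⟨ n%n≡0 d ⟩
      0                                 ∎)

  reflectF : ℕ → Fin d → Fin d
  reflectF c i = addF (negF i) c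

  reflectF-involutive : (c : ℕ) (i : Fin d) → reflectF c (reflectF c i) ≡ i
  reflectF-involutive c i = addF-cancelʳ (toℕ r) (begin
    addF (reflectF c r) (toℕ r)    ≡⟨ addF-negF r c ⟩
    addF Fin.zero c                ≡⟨ addF-negF i c ⟨
    addF r (toℕ i)                 ≡⟨ addF-comm r i ⟩
    addF i (toℕ r)                 ∎)
    where
    r = reflectF c i

  sucF-reflectF-sucF : (c : ℕ) (i : Fin d) → sucF (reflectF c (sucF i)) ≡ reflectF c i
  sucF-reflectF-sucF c i = addF-cancelʳ (toℕ (sucF i)) (begin
    addF (sucF (reflectF c (sucF i))) (toℕ (sucF i))   ≡⟨ addF-sucF (reflectF c (sucF i)) (toℕ (sucF i)) ⟩
    sucF (addF (reflectF c (sucF i)) (toℕ (sucF i)))   ≡⟨ cong sucF (addF-negF (sucF i) c) ⟩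
    sucF (addF Fin.zero c)                             ≡⟨ cong sucF (addF-negF i c) ⟨
    sucF (addF (reflectF c i) (toℕ i))                 ≡⟨ cong sucF (addF-comm (reflectF c i) i) ⟩
    sucF (addF i (toℕ (reflectF c i)))                 ≡⟨ addF-sucF i (toℕ (reflectF c i)) ⟨
    addF (sucF i) (toℕ (reflectF c i))                 ≡⟨ addF-comm (sucF i) (reflectF c i) ⟩
    addF (reflectF c i) (toℕ (sucF i))                 ∎)

Adjacent : ∀ {d} → Fin d → Fin d → Set
Adjacent i j = j ≡ sucF i ⊎ i ≡ sucF j

Adjacent-sym : ∀ {d} {i j : Fin d} → Adjacent i j → Adjacent j i
Adjacent-sym = Sum.swap

PreservesAdjacency : ∀ {d} → (Fin d → Fin d) → Set
PreservesAdjacency σ = ∀ i → Adjacent (σ i) (σ (sucF i))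

addF-preservesAdjacency : ∀ {D} (k : ℕ) → PreservesAdjacency {suc D} (λ i → addF i k)
addF-preservesAdjacency k i = inj₁ (addF-sucF i k)

reflectF-preservesAdjacency : ∀ {D} (c k : ℕ) → PreservesAdjacency {suc D} (λ i → addF (reflectF c i) k)
reflectF-preservesAdjacency c k i = inj₂ (begin
  addF (reflectF c i) k                 ≡⟨ cong (λ j → addF j k) (sucF-reflectF-sucF c i) ⟨
  addF (sucF (reflectF c (sucF i))) k   ≡⟨ addF-sucF (reflectF c (sucF i)) k ⟩
  sucF (addF (reflectF c (sucF i)) k)   ∎)

-- Cross edges

eqB-refl : ∀ {m} (a : Fin m) → eqB a a ≡ true
eqB-refl a = dec-true (a Fin.≟ a) refl

eqB∧eqB-sound : ∀ {m m'} (a a' : Fin m) (b b' : Fin m') → eqB a a' ∧ eqB b b' ≡ true → a ≡ a' × b ≡ b'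
eqB∧eqB-sound a a' b b' e with a Fin.≟ a' | b Fin.≟ b'
... | yes a≡a' | yes b≡b' = a≡a' , b≡b'

∨-sound : ∀ {x y} → x ∨ y ≡ true → x ≡ true ⊎ y ≡ true
∨-sound {true}  _ = inj₁ refl
∨-sound {false} e = inj₂ e

∨-introˡ : ∀ {x y} → x ≡ true → x ∨ y ≡ true
∨-introˡ refl = refl

∨-introʳ : ∀ {x y} → y ≡ true → x ∨ y ≡ true
∨-introʳ {x} refl = ∨-zeroʳ x

∧-intro : ∀ {x y} → x ≡ true → y ≡ true → x ∧ y ≡ true
∧-intro refl refl = refl

anyFin-sound : ∀ {m} {p : Fin m → Bool} → anyFin p ≡ true → ∃ λ i → p i ≡ true
anyFin-sound {suc m} {p} e with p Fin.zero in p₀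
... | true  = Fin.zero , p₀
... | false = Prod.map Fin.suc id (anyFin-sound e)

anyFin-complete : ∀ {m} {p : Fin m → Bool} (i : Fin m) → p i ≡ true → anyFin p ≡ true
anyFin-complete Fin.zero    e = ∨-introˡ e
anyFin-complete (Fin.suc i) e = ∨-introʳ (anyFin-complete i e)

-- cycEdge w is definitionally crossEdge w w, so everything below covers cyclet edges too.
module _ {m₁ m₂ D} (w₁ : Fin (suc D) → Fin m₁) (w₂ : Fin (suc D) → Fin m₂) where

  data CrossEdge : Fin m₁ → Fin m₂ → Set where
    forward  : ∀ i → CrossEdge (w₁ i) (w₂ (sucF i))
    backward : ∀ i → CrossEdge (w₁ (sucF i)) (w₂ i)

  private
    crossEdgeAt : Fin m₁ → Fin m₂ → Fin (suc D) → Bool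
    crossEdgeAt a b i = (eqB (w₁ i) a ∧ eqB (w₂ (sucF i)) b) ∨ (eqB (w₂ i) b ∧ eqB (w₁ (sucF i)) a)

  crossEdge-sound : ∀ {a b} → crossEdge w₁ w₂ a b ≡ true → CrossEdge a b
  crossEdge-sound {a} {b} e with anyFin-sound e
  ... | i , eᵢ with ∨-sound eᵢ
  ...   | inj₁ fwd with eqB∧eqB-sound (w₁ i) a (w₂ (sucF i)) b fwd
  ...     | refl , refl = forward i
  crossEdge-sound {a} {b} e | i , eᵢ | inj₂ bwd with eqB∧eqB-sound (w₂ i) b (w₁ (sucF i)) a bwd
  ...     | refl , refl = backward i

  crossEdge-complete : ∀ {a b} → CrossEdge a b → crossEdge w₁ w₂ a b ≡ true
  crossEdge-complete (forward i) = anyFin-complete {p = crossEdgeAt (w₁ i) (w₂ (sucF i))} i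
    (∨-introˡ (∧-intro (eqB-refl (w₁ i)) (eqB-refl (w₂ (sucF i)))))
  crossEdge-complete (backward i) = anyFin-complete {p = crossEdgeAt (w₁ (sucF i)) (w₂ i)} i
    (∨-introʳ (∧-intro (eqB-refl (w₂ i)) (eqB-refl (w₁ (sucF i)))))

  CrossEdge-Adjacent : ∀ {i j} → Adjacent i j → CrossEdge (w₁ i) (w₂ j)
  CrossEdge-Adjacent {i}     (inj₁ refl) = forward i
  CrossEdge-Adjacent {j = j} (inj₂ refl) = backward j

  CrossEdge-source : ∀ {a b} → CrossEdge a b → ∃ λ i → w₁ i ≡ a
  CrossEdge-source (forward i)  = i , refl
  CrossEdge-source (backward i) = sucF i , refl

  CrossEdge-neighbours : (∀ i j → w₁ i ≡ w₁ j → i ≡ j) → ∀ {i a b} → w₁ i ≡ a → CrossEdge a b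
    → b ≡ w₂ (sucF i) ⊎ b ≡ w₂ (predF i)
  CrossEdge-neighbours w₁-injective {i} eq (forward j) with w₁-injective i j eq
  ... | refl = inj₁ refl
  CrossEdge-neighbours w₁-injective {i} eq (backward j) with w₁-injective i (sucF j) eq
  ... | refl = inj₂ (cong w₂ (sym (predF-sucF j)))

CrossEdge-swap : ∀ {m₁ m₂ D} {w₁ : Fin (suc D) → Fin m₁} {w₂ : Fin (suc D) → Fin m₂} {a b}
  → CrossEdge w₁ w₂ a b → CrossEdge w₂ w₁ b a
CrossEdge-swap (forward i)  = backward i
CrossEdge-swap (backward i) = forward i

crossEdge-swap : ∀ {m₁ m₂ D} (w₁ : Fin (suc D) → Fin m₁) (w₂ : Fin (suc D) → Fin m₂) a b
  → crossEdge w₁ w₂ a b ≡ crossEdge w₂ w₁ b a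
crossEdge-swap w₁ w₂ a b = ⇔→≡ (mk⇔
  (crossEdge-complete w₂ w₁ ∘ CrossEdge-swap ∘ crossEdge-sound w₁ w₂)
  (crossEdge-complete w₁ w₂ ∘ CrossEdge-swap ∘ crossEdge-sound w₂ w₁))

IsRevAlong : ∀ {m d} → (Fin m → ℤ) → (Fin d → Fin m) → (Fin d → Fin d) → Set
IsRevAlong ℓ w σ = ∀ i → IsRev ℓ (w i) (w (σ i))

IsRev-sym : ∀ {m} {ℓ : Fin m → ℤ} {a b} → IsRev ℓ a b → IsRev ℓ b a
IsRev-sym {ℓ = ℓ} {a} {b} r = trans (ℤP.+-comm (ℓ b) (ℓ a)) r

IsRev-unique : ∀ {m} {ℓ : Fin m → ℤ} → (∀ x y → ℓ x ≡ ℓ y → x ≡ y)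
  → ∀ {a x y} → IsRev ℓ a x → IsRev ℓ a y → x ≡ y
IsRev-unique {ℓ = ℓ} ℓ-injective {a} {x} {y} rx ry =
  ℓ-injective x y (trans (inverseʳ-unique (ℓ a) (ℓ x) rx) (sym (inverseʳ-unique (ℓ a) (ℓ y) ry)))

module _ {m₁ m₂ D} {w₁ : Fin (suc D) → Fin m₁} {w₂ : Fin (suc D) → Fin m₂}
         {ℓ₁ : Fin m₁ → ℤ} {ℓ₂ : Fin m₂ → ℤ}
         (ℓ₁-injective : ∀ x y → ℓ₁ x ≡ ℓ₁ y → x ≡ y)
         (ℓ₂-injective : ∀ x y → ℓ₂ x ≡ ℓ₂ y → x ≡ y)
         {σ : Fin (suc D) → Fin (suc D)} (σ-adjacency : PreservesAdjacency σ)
         (w₁-rev : IsRevAlong ℓ₁ w₁ σ) (w₂-rev : IsRevAlong ℓ₂ w₂ σ) where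

  CrossEdge-reverse : ∀ {a a* b b*} → IsRev ℓ₁ a a* → IsRev ℓ₂ b b*
    → CrossEdge w₁ w₂ a b → CrossEdge w₁ w₂ a* b*
  CrossEdge-reverse ra rb (forward i)
    with IsRev-unique ℓ₁-injective ra (w₁-rev i) | IsRev-unique ℓ₂-injective rb (w₂-rev (sucF i))
  ... | refl | refl = CrossEdge-Adjacent w₁ w₂ (σ-adjacency i)
  CrossEdge-reverse ra rb (backward i)
    with IsRev-unique ℓ₁-injective ra (w₁-rev (sucF i)) | IsRev-unique ℓ₂-injective rb (w₂-rev i)
  ... | refl | refl = CrossEdge-Adjacent w₁ w₂ (Adjacent-sym (σ-adjacency i))

  crossEdge-reverse : ∀ {a a* b b*} → IsRev ℓ₁ a a* → IsRev ℓ₂ b b*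
    → crossEdge w₁ w₂ a b ≡ crossEdge w₁ w₂ a* b*
  crossEdge-reverse ra rb = ⇔→≡ (mk⇔
    (crossEdge-complete w₁ w₂ ∘ CrossEdge-reverse ra rb ∘ crossEdge-sound w₁ w₂)
    (crossEdge-complete w₁ w₂ ∘ CrossEdge-reverse (IsRev-sym {ℓ = ℓ₁} ra) (IsRev-sym {ℓ = ℓ₂} rb)
                              ∘ crossEdge-sound w₁ w₂))

-- Finite sums

sumℤ-cong : ∀ {m} {f g : Fin m → ℤ} → (∀ x → f x ≡ g x) → sumℤ f ≡ sumℤ g
sumℤ-cong {zero}  f≗g = refl
sumℤ-cong {suc m} f≗g = cong₂ _+_ (f≗g Fin.zero) (sumℤ-cong (f≗g ∘ Fin.suc))

sumℤ-zero : ∀ m → sumℤ {m} (λ _ → 0ℤ) ≡ 0ℤ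
sumℤ-zero zero    = refl
sumℤ-zero (suc m) = trans (ℤP.+-identityˡ _) (sumℤ-zero m)

sumℤ-+ : ∀ {m} (f g : Fin m → ℤ) → sumℤ (λ x → f x + g x) ≡ sumℤ f + sumℤ g
sumℤ-+ {zero}  f g = refl
sumℤ-+ {suc m} f g = trans (cong (_+_ (f Fin.zero + g Fin.zero)) (sumℤ-+ (f ∘ Fin.suc) (g ∘ Fin.suc)))
                           (interchange (f Fin.zero) (g Fin.zero) (sumℤ (f ∘ Fin.suc)) (sumℤ (g ∘ Fin.suc)))

sumℤ-neg : ∀ {m} (f : Fin m → ℤ) → sumℤ (λ x → - f x) ≡ - sumℤ f
sumℤ-neg {zero}  f = refl
sumℤ-neg {suc m} f = trans (cong (_+_ (- f Fin.zero)) (sumℤ-neg (f ∘ Fin.suc)))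
                           (sym (ℤP.neg-distrib-+ (f Fin.zero) (sumℤ (f ∘ Fin.suc))))

sumℤ-*ˡ : ∀ {m} (c : ℤ) (f : Fin m → ℤ) → sumℤ (λ x → c ℤ.* f x) ≡ c ℤ.* sumℤ f
sumℤ-*ˡ {zero}  c f = sym (ℤP.*-zeroʳ c)
sumℤ-*ˡ {suc m} c f = trans (cong (_+_ (c ℤ.* f Fin.zero)) (sumℤ-*ˡ c (f ∘ Fin.suc)))
                            (sym (ℤP.*-distribˡ-+ c (f Fin.zero) (sumℤ (f ∘ Fin.suc))))

sumℤ-comm : ∀ {m m'} (f : Fin m → Fin m' → ℤ)
  → sumℤ (λ x → sumℤ (λ y → f x y)) ≡ sumℤ (λ y → sumℤ (λ x → f x y))
sumℤ-comm {zero}  {m'} f = sym (sumℤ-zero m')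
sumℤ-comm {suc m} f = trans (cong (_+_ (sumℤ (f Fin.zero))) (sumℤ-comm (f ∘ Fin.suc)))
                            (sym (sumℤ-+ (f Fin.zero) (λ y → sumℤ (λ x → f (Fin.suc x) y))))

sumℤ-↑ : ∀ m {m'} (f : Fin (m ℕ.+ m') → ℤ)
  → sumℤ f ≡ sumℤ (λ a → f (a ↑ˡ m')) + sumℤ (λ b → f (m ↑ʳ b))
sumℤ-↑ zero    f = sym (ℤP.+-identityˡ (sumℤ f))
sumℤ-↑ (suc m) f = trans (cong (_+_ (f Fin.zero)) (sumℤ-↑ m (f ∘ Fin.suc))) (sym (ℤP.+-assoc (f Fin.zero) _ _))

restrict : ∀ {m} → (Fin m → Bool) → (Fin m → ℤ) → Fin m → ℤ
restrict p f x = if p x then f x else 0ℤ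

sumOver : ∀ {m} → (Fin m → Bool) → (Fin m → ℤ) → ℤ
sumOver p f = sumℤ (restrict p f)

sumOver-cong : ∀ {m} {p q : Fin m → Bool} {f g : Fin m → ℤ} → (∀ x → p x ≡ q x) → (∀ x → f x ≡ g x)
  → sumOver p f ≡ sumOver q g
sumOver-cong p≗q f≗g = sumℤ-cong (λ x → cong₂ (λ e z → if e then z else 0ℤ) (p≗q x) (f≗g x))

sumOver-+ : ∀ {m} (p : Fin m → Bool) (f g : Fin m → ℤ) → sumOver p (λ x → f x + g x) ≡ sumOver p f + sumOver p g
sumOver-+ p f g = trans (sumℤ-cong split) (sumℤ-+ (restrict p f) (restrict p g))
  where
  split : ∀ x → restrict p (λ x → f x + g x) x ≡ restrict p f x + restrict p g x
  split x with p x
  ... | true  = refl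
  ... | false = refl

sumOver-∧-not : ∀ {m} (p q : Fin m → Bool) (f : Fin m → ℤ) → (∀ x → q x ≡ true → p x ≡ true)
  → sumOver (λ x → p x ∧ not (q x)) f ≡ sumOver p f - sumOver q f
sumOver-∧-not p q f q⇒p = begin
  sumOver (λ x → p x ∧ not (q x)) f              ≡⟨ sumℤ-cong split ⟩
  sumℤ (λ x → restrict p f x - restrict q f x)   ≡⟨ sumℤ-+ (restrict p f) (λ x → - restrict q f x) ⟩
  sumOver p f + sumℤ (λ x → - restrict q f x)    ≡⟨ cong (_+_ (sumOver p f)) (sumℤ-neg (restrict q f)) ⟩
  sumOver p f - sumOver q f                      ∎
  where
  split : ∀ x → restrict (λ x → p x ∧ not (q x)) f x ≡ restrict p f x - restrict q f x
  split x with p x in px | q x in qx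
  ... | true  | true  = sym (ℤP.+-inverseʳ (f x))
  ... | true  | false = sym (ℤP.+-identityʳ (f x))
  ... | false | false = refl
  ... | false | true  with () ← trans (sym px) (q⇒p x qx)

sumOver-eqB : ∀ {m} (a : Fin m) (f : Fin m → ℤ) → sumOver (eqB a) f ≡ f a
sumOver-eqB {suc m} Fin.zero    f = trans (cong (_+_ (f Fin.zero)) (sumℤ-zero m)) (ℤP.+-identityʳ (f Fin.zero))
sumOver-eqB {suc m} (Fin.suc a) f = trans (ℤP.+-identityˡ _) (sumOver-eqB a (f ∘ Fin.suc))

sumOver-pair : ∀ {m} (p : Fin m → Bool) (f : Fin m → ℤ) {a b : Fin m} → a ≢ b
  → p a ≡ true → p b ≡ true → (∀ x → p x ≡ true → x ≡ a ⊎ x ≡ b)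
  → sumOver p f ≡ f a + f b
sumOver-pair p f {a} {b} a≢b pa pb only-a-b = begin
  sumOver p f                                               ≡⟨ sumℤ-cong split ⟩
  sumℤ (λ x → restrict (eqB a) f x + restrict (eqB b) f x)  ≡⟨ sumℤ-+ (restrict (eqB a) f) (restrict (eqB b) f) ⟩
  sumOver (eqB a) f + sumOver (eqB b) f                     ≡⟨ cong₂ _+_ (sumOver-eqB a f) (sumOver-eqB b f) ⟩
  f a + f b                                                 ∎
  where
  split : ∀ x → restrict p f x ≡ restrict (eqB a) f x + restrict (eqB b) f x
  split x with p x in px | a Fin.≟ x | b Fin.≟ x
  ... | _     | yes refl | yes refl = ⊥-elim (a≢b refl)
  ... | true  | yes refl | no _     = sym (ℤP.+-identityʳ (f x))
  ... | true  | no _     | yes refl = sym (ℤP.+-identityˡ (f x))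
  ... | true  | no a≢x   | no b≢x   = ⊥-elim (Sum.[ a≢x ∘ sym , b≢x ∘ sym ] (only-a-b x px))
  ... | false | no _     | no _     = refl
  ... | false | yes refl | no _     with () ← trans (sym px) pa
  ... | false | no _     | yes refl with () ← trans (sym px) pb

sumOver-const : ∀ {m} (p : Fin m → Bool) (c : ℤ) → sumOver p (λ _ → c) ≡ + count p ℤ.* c
sumOver-const {zero}  p c = sym (ℤP.*-zeroˡ c)
sumOver-const {suc m} p c with p Fin.zero
... | true  = trans (cong (_+_ c) (sumOver-const (p ∘ Fin.suc) c)) (sym (ℤP.suc-* (+ count (p ∘ Fin.suc)) c))
... | false = trans (ℤP.+-identityˡ _) (sumOver-const (p ∘ Fin.suc) c)

sumOver-signed : ∀ {m} (p s : Fin m → Bool) (c : ℤ)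
  → sumOver p (λ x → if s x then c else - c)
    ≡ (+ count (λ x → p x ∧ s x) - + count (λ x → p x ∧ not (s x))) ℤ.* c
sumOver-signed p s c = begin
  sumOver p (λ x → if s x then c else - c)                     ≡⟨ sumℤ-cong split ⟩
  sumℤ (λ x → restrict p∧s (λ _ → c) x + restrict p∧¬s (λ _ → - c) x)
    ≡⟨ sumℤ-+ (restrict p∧s (λ _ → c)) (restrict p∧¬s (λ _ → - c)) ⟩
  sumOver p∧s (λ _ → c) + sumOver p∧¬s (λ _ → - c)
    ≡⟨ cong₂ _+_ (sumOver-const p∧s c) (sumOver-const p∧¬s (- c)) ⟩
  + count p∧s ℤ.* c + + count p∧¬s ℤ.* - c                      ≡⟨ collect (+ count p∧s) (+ count p∧¬s) c ⟩
  (+ count p∧s - + count p∧¬s) ℤ.* c                            ∎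
  where
  p∧s p∧¬s : _ → Bool
  p∧s  x = p x ∧ s x
  p∧¬s x = p x ∧ not (s x)
  split : ∀ x → restrict p (λ x → if s x then c else - c) x
                ≡ restrict p∧s (λ _ → c) x + restrict p∧¬s (λ _ → - c) x
  split x with p x | s x
  ... | true  | true  = sym (ℤP.+-identityʳ c)
  ... | true  | false = sym (ℤP.+-identityˡ (- c))
  ... | false | _     = refl
  collect : ∀ k l c → k ℤ.* c + l ℤ.* - c ≡ (k - l) ℤ.* c
  collect = solve-∀

module _ {m₁ m₂ D} (w₁ : Fin (suc D) → Fin m₁) (w₂ : Fin (suc D) → Fin m₂) where

  sumOver-crossEdge-off : ∀ {a} → (∀ i → w₁ i ≢ a) → (g : Fin m₂ → ℤ)
    → sumOver (crossEdge w₁ w₂ a) g ≡ 0ℤ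
  sumOver-crossEdge-off {a} off g =
    trans (sumOver-cong {q = λ _ → false} {g = g} no-edge (λ _ → refl)) (sumℤ-zero m₂)
    where
    no-edge : ∀ b → crossEdge w₁ w₂ a b ≡ false
    no-edge b = ¬-not (λ e → let i , wᵢ≡a = CrossEdge-source w₁ w₂ (crossEdge-sound w₁ w₂ e) in off i wᵢ≡a)

  sumOver-crossEdge-on : (∀ i j → w₁ i ≡ w₁ j → i ≡ j) → (∀ i j → w₂ i ≡ w₂ j → i ≡ j) → 2 < suc D
    → ∀ i (g : Fin m₂ → ℤ) → sumOver (crossEdge w₁ w₂ (w₁ i)) g ≡ g (w₂ (sucF i)) + g (w₂ (predF i))
  sumOver-crossEdge-on w₁-injective w₂-injective 2<d i g = sumOver-pair (crossEdge w₁ w₂ (w₁ i)) g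
    (sucF≢predF 2<d i ∘ w₂-injective (sucF i) (predF i))
    (crossEdge-complete w₁ w₂ (forward i))
    (crossEdge-complete w₁ w₂ (CrossEdge-Adjacent w₁ w₂ (inj₂ (sym (sucF-predF i)))))
    (λ b e → CrossEdge-neighbours w₁ w₂ w₁-injective refl (crossEdge-sound w₁ w₂ e))

-- Balanced bipartitions

balanced-signed-sum : ∀ {m} {adj : Adj m} {s : Fin m → Bool} → IsBalanced adj s
  → ∀ a c → sumOver (adj a) (λ b → if s b then c else - c) ≡ 0ℤ
balanced-signed-sum {adj = adj} {s} balanced a c = begin
  sumOver (adj a) (λ b → if s b then c else - c)                            ≡⟨ sumOver-signed (adj a) s c ⟩
  (+ count (λ b → adj a b ∧ s b) - + count (λ b → adj a b ∧ not (s b))) ℤ.* c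
    ≡⟨ cong (λ k → (+ count (λ b → adj a b ∧ s b) - + k) ℤ.* c) (balanced a) ⟨
  (+ count (λ b → adj a b ∧ s b) - + count (λ b → adj a b ∧ s b)) ℤ.* c
    ≡⟨ cong (ℤ._* c) (ℤP.+-inverseʳ (+ count (λ b → adj a b ∧ s b))) ⟩
  0ℤ ℤ.* c                                                                  ≡⟨ ℤP.*-zeroˡ c ⟩
  0ℤ                                                                        ∎

count-not : ∀ {m} (s : Fin m → Bool) → count s ℕ.+ count (not ∘ s) ≡ m
count-not {zero}  s = refl
count-not {suc m} s with s Fin.zero
... | true  = cong suc (count-not (s ∘ Fin.suc))
... | false = trans (ℕP.+-suc _ _) (cong suc (count-not (s ∘ Fin.suc)))

-- Sum the sign of b over all edges ab in both orders: 0 by balance, r (|A| − |B|) by regularity.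
balanced-halves : ∀ {m r} .{{_ : NonZero r}} (adj : Adj m) (s : Fin m → Bool)
  → (∀ a b → adj a b ≡ adj b a) → IsRegular adj r → IsBalanced adj s
  → count s ≡ count (not ∘ s)
balanced-halves {m} {r} adj s adj-sym regular balanced =
  ℤP.+-injective (ℤP.i-j≡0⇒i≡j _ _ (ℤP.*-cancelˡ-≡ (+ r) _ 0ℤ (begin
    + r ℤ.* (+ count s - + count (not ∘ s))            ≡⟨ cong (+ r ℤ.*_) (ℤP.*-identityʳ _) ⟨
    + r ℤ.* ((+ count s - + count (not ∘ s)) ℤ.* 1ℤ)   ≡⟨ cong (+ r ℤ.*_) (sumOver-signed (λ _ → true) s 1ℤ) ⟨
    + r ℤ.* sumℤ sign                                  ≡⟨ sumℤ-*ˡ (+ r) sign ⟨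
    sumℤ (λ b → + r ℤ.* sign b)
      ≡⟨ sumℤ-cong (λ b → cong (λ k → + k ℤ.* sign b) (regular b)) ⟨
    sumℤ (λ b → + count (adj b) ℤ.* sign b)            ≡⟨ sumℤ-cong (λ b → sumOver-const (adj b) (sign b)) ⟨
    sumℤ (λ b → sumOver (adj b) (λ _ → sign b))
      ≡⟨ sumℤ-cong (λ b → sumℤ-cong (λ a → cong (λ e → if e then sign b else 0ℤ) (adj-sym b a))) ⟩
    sumℤ (λ b → sumℤ (λ a → restrict (adj a) sign b))  ≡⟨ sumℤ-comm (λ a b → restrict (adj a) sign b) ⟨
    sumℤ (λ a → sumOver (adj a) sign)
      ≡⟨ sumℤ-cong (λ a → balanced-signed-sum {adj = adj} balanced a 1ℤ) ⟩
    sumℤ {m} (λ _ → 0ℤ)                                ≡⟨ sumℤ-zero m ⟩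
    0ℤ                                                 ≡⟨ ℤP.*-zeroʳ (+ r) ⟨
    + r ℤ.* 0ℤ                                         ∎)))
  where
  sign : Fin m → ℤ
  sign b = if s b then 1ℤ else - 1ℤ

xor-alternation : ∀ a b c → a xor b ≡ not (c xor a) → b ≡ not c
xor-alternation true  true  true  ()
xor-alternation true  true  false _ = refl
xor-alternation true  false true  _ = refl
xor-alternation true  false false ()
xor-alternation false true  true  ()
xor-alternation false true  false _ = refl
xor-alternation false false true  _ = refl
xor-alternation false false false ()

alternating-opposite : ∀ {m D} {s : Fin m → Bool} {w : Fin (suc D) → Fin m} → IsAlternating s w
  → ∀ i → s (w (sucF i)) ≡ not (s (w (predF i)))
alternating-opposite {s = s} {w} alternating i = xor-alternation (s (w i)) (s (w (sucF i))) (s (w (predF i)))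
  (subst (λ j → isLink s (w j) (w (sucF j)) ≡ not (isLink s (w (predF i)) (w j))) (sucF-predF i) (alternating (predF i)))

-- Labels: I_m and the shift away from zero

+a-+b≡+c-+d : ∀ a b c e → a ℕ.+ e ≡ c ℕ.+ b → + a - + b ≡ + c - + e
+a-+b≡+c-+d a b c e eq = begin
  + a - + b              ≡⟨ ℤP.m-n≡m⊖n a b ⟩
  a ⊖ b                  ≡⟨ ℤP.+-cancelˡ-⊖ e a b ⟨
  (e ℕ.+ a) ⊖ (e ℕ.+ b)  ≡⟨ cong₂ _⊖_ (trans (ℕP.+-comm e a) (trans eq (ℕP.+-comm c b))) (ℕP.+-comm e b) ⟩
  (b ℕ.+ c) ⊖ (b ℕ.+ e)  ≡⟨ ℤP.+-cancelˡ-⊖ b c e ⟩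
  c ⊖ e                  ≡⟨ ℤP.m-n≡m⊖n c e ⟨
  + c - + e              ∎

+a-+b++c : ∀ a b c → (+ a - + b) + + c ≡ + (a ℕ.+ c) - + b
+a-+b++c a b c = trans (reorder (+ a) (+ b) (+ c)) (cong (_- + b) (sym (ℤP.pos-+ a c)))
  where
  reorder : ∀ x y z → (x - y) + z ≡ (x + z) - y
  reorder = solve-∀

+a-+b-+c : ∀ a b c → (+ a - + b) - + c ≡ + a - + (c ℕ.+ b)
+a-+b-+c a b c = trans (reorder (+ a) (+ b) (+ c)) (cong (λ z → + a - z) (sym (ℤP.pos-+ c b)))
  where
  reorder : ∀ x y z → (x - y) - z ≡ x - (z + y)
  reorder = solve-∀

shiftAway : ℕ → ℤ → ℤ
shiftAway n y = if inA y then y + + n else y - + n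

module _ {n : ℕ} where

  shiftAway-nonneg : ∀ {y} → 0ℤ ℤ.≤ y → shiftAway n y ≡ y + + n
  shiftAway-nonneg {y} 0≤y rewrite dec-true (0ℤ ℤ.≤? y) 0≤y = refl

  shiftAway-neg : ∀ {y} → y ℤ.< 0ℤ → shiftAway n y ≡ y - + n
  shiftAway-neg {y} y<0 rewrite dec-false (0ℤ ℤ.≤? y) (ℤP.<⇒≱ y<0) = refl

  n≤y+n : ∀ {y} → 0ℤ ℤ.≤ y → + n ℤ.≤ y + + n
  n≤y+n 0≤y = ℤP.+-monoˡ-≤ (+ n) 0≤y

  y-n<-n : ∀ {y} → y ℤ.< 0ℤ → y - + n ℤ.< - + n
  y-n<-n {y} y<0 = subst (y - + n ℤ.<_) (ℤP.+-identityˡ (- + n)) (ℤP.+-monoˡ-< (- + n) y<0)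

  -n≤n : - + n ℤ.≤ + n
  -n≤n = ℤP.neg-≤-pos

  shiftAway-opposite : ∀ {y z} → inA y ≡ not (inA z) → shiftAway n y + shiftAway n z ≡ y + z
  shiftAway-opposite {y} {z} opp with inA y | inA z
  ... | true  | false = cancel y z (+ n)
    where
    cancel : ∀ a b c → (a + c) + (b - c) ≡ a + b
    cancel = solve-∀
  ... | false | true  = cancel y z (+ n)
    where
    cancel : ∀ a b c → (a - c) + (b + c) ≡ a + b
    cancel = solve-∀

  shiftAway-injective : ∀ {y z} → shiftAway n y ≡ shiftAway n z → y ≡ z
  shiftAway-injective {y} {z} eq with 0ℤ ℤ.≤? y | 0ℤ ℤ.≤? z
  ... | yes _ | yes _ = ∙-cancelʳ (+ n) y z eq
  ... | no  _ | no  _ = ∙-cancelʳ (- + n) y z eq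
  ... | yes p | no q  = ⊥-elim (ℤP.<⇒≱ (y-n<-n (ℤP.≰⇒> q)) (ℤP.≤-trans -n≤n (subst (+ n ℤ.≤_) eq (n≤y+n p))))
  ... | no  q | yes p =
    ⊥-elim (ℤP.<⇒≱ (y-n<-n (ℤP.≰⇒> q)) (ℤP.≤-trans -n≤n (subst (+ n ℤ.≤_) (sym eq) (n≤y+n p))))

  shiftAway-avoids : ∀ {x} y → - + n ℤ.< x → x ℤ.< + n → x ≢ shiftAway n y
  shiftAway-avoids y -n<x x<n eq with 0ℤ ℤ.≤? y
  ... | yes p = ℤP.<⇒≱ x<n (subst (+ n ℤ.≤_) (sym eq) (n≤y+n p))
  ... | no  q = ℤP.<-asym -n<x (subst (ℤ._< - + n) (sym eq) (y-n<-n (ℤP.≰⇒> q)))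

  shiftAway-+≡0 : .{{_ : NonZero n}} → ∀ {y z} → shiftAway n y + shiftAway n z ≡ 0ℤ → y + z ≡ 0ℤ
  shiftAway-+≡0 {y} {z} eq with 0ℤ ℤ.≤? y | 0ℤ ℤ.≤? z
  ... | yes p | yes q = ⊥-elim (ℤP.<-irrefl (sym eq) (ℤP.+-mono-< (above p) (above q)))
    where
    above : ∀ {y} → 0ℤ ℤ.≤ y → 0ℤ ℤ.< y + + n
    above 0≤y = ℤP.<-≤-trans (ℤ.+<+ (ℕ.>-nonZero⁻¹ n)) (n≤y+n 0≤y)
  ... | no  p | no  q = ⊥-elim (ℤP.<-irrefl eq (ℤP.+-mono-< (below (ℤP.≰⇒> p)) (below (ℤP.≰⇒> q))))
    where
    below : ∀ {y} → y ℤ.< 0ℤ → y - + n ℤ.< 0ℤ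
    below y<0 = ℤP.<-≤-trans (y-n<-n y<0) ℤP.neg-≤-pos
  ... | yes _ | no  _ = trans (sym (cancel y z (+ n))) eq
    where
    cancel : ∀ a b c → (a + c) + (b - c) ≡ a + b
    cancel = solve-∀
  ... | no  _ | yes _ = trans (sym (cancel y z (+ n))) eq
    where
    cancel : ∀ a b c → (a - c) + (b + c) ≡ a + b
    cancel = solve-∀

2j+1<m+m : ∀ {j m} → j < m → 2 * j ℕ.+ 1 < m ℕ.+ m
2j+1<m+m {j} {m} j<m = subst (ℕ._≤ m ℕ.+ m) (double j) (ℕP.+-mono-≤ j<m j<m)
  where
  double : ∀ j → suc j ℕ.+ suc j ≡ suc (2 * j ℕ.+ 1)
  double = ℕSolver.solve-∀

InI-bounds : ∀ {m x} → InI m x → - + m ℤ.< x × x ℤ.< + m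
InI-bounds {m} (j , j<m , refl) =
  subst (ℤ._< x) (ℤP.+-identityˡ (- + m)) (ℤP.+-monoˡ-< (- + m) (ℤ.+<+ (ℕP.m≤n+m 1 (2 * j)))) ,
  subst (x ℤ.<_) (trans (+a-+b≡+c-+d (m ℕ.+ m) m m 0 (ℕP.+-identityʳ (m ℕ.+ m))) (ℤP.+-identityʳ (+ m)))
    (ℤP.+-monoˡ-< (- + m) (ℤ.+<+ (2j+1<m+m j<m)))
  where
  x = + (2 * j ℕ.+ 1) - + m

InI-neg : ∀ {m x} → InI m x → InI m (- x)
InI-neg (j , j<m , refl) with ℕP.m≤n⇒∃[o]m+o≡n j<m
... | t , refl = t , ℕP.m<n+m t z<s , trans (negate (+ (2 * j ℕ.+ 1)) (+ (suc j ℕ.+ t)))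
  (+a-+b≡+c-+d (suc j ℕ.+ t) (2 * j ℕ.+ 1) (2 * t ℕ.+ 1) (suc j ℕ.+ t) (reflect j t))
  where
  negate : ∀ a b → - (a - b) ≡ b - a
  negate = solve-∀
  reflect : ∀ j t → suc j ℕ.+ t ℕ.+ (suc j ℕ.+ t) ≡ 2 * t ℕ.+ 1 ℕ.+ (2 * j ℕ.+ 1)
  reflect = ℕSolver.solve-∀

InI-widen : ∀ {m x} h → InI m x → InI (m ℕ.+ (h ℕ.+ h)) x
InI-widen {m} h (j , j<m , refl) =
  j ℕ.+ h , ℕP.+-mono-<-≤ j<m (ℕP.m≤m+n h h) ,
  +a-+b≡+c-+d (2 * j ℕ.+ 1) m (2 * (j ℕ.+ h) ℕ.+ 1) (m ℕ.+ (h ℕ.+ h)) (reindex j m h)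
  where
  reindex : ∀ j m h → 2 * j ℕ.+ 1 ℕ.+ (m ℕ.+ (h ℕ.+ h)) ≡ 2 * (j ℕ.+ h) ℕ.+ 1 ℕ.+ m
  reindex = ℕSolver.solve-∀

InI-shiftAway : ∀ {m y} n → InI m y → InI (n ℕ.+ m) (shiftAway n y)
InI-shiftAway {m} n (j , j<m , refl) with 0ℤ ℤ.≤? (+ (2 * j ℕ.+ 1) - + m)
... | yes _ = n ℕ.+ j , ℕP.+-monoʳ-< n j<m ,
              trans (+a-+b++c (2 * j ℕ.+ 1) m n)
                (+a-+b≡+c-+d (2 * j ℕ.+ 1 ℕ.+ n) m (2 * (n ℕ.+ j) ℕ.+ 1) (n ℕ.+ m) (reindex j m n))
  where
  reindex : ∀ j m n → 2 * j ℕ.+ 1 ℕ.+ n ℕ.+ (n ℕ.+ m) ≡ 2 * (n ℕ.+ j) ℕ.+ 1 ℕ.+ m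
  reindex = ℕSolver.solve-∀
... | no  _ = j , ℕP.<-≤-trans j<m (ℕP.m≤n+m m n) , +a-+b-+c (2 * j ℕ.+ 1) m n

InI-merge : ∀ {x} n h → InI (n ℕ.+ (h ℕ.+ h)) x → InI n x ⊎ ∃ λ y → InI (h ℕ.+ h) y × shiftAway n y ≡ x
InI-merge n h (j , j<N , refl) with j <? h
... | yes j<h = inj₂ (y , (j , ℕP.<-≤-trans j<h (ℕP.m≤m+n h h) , refl) , shifted)
  where
  y = + (2 * j ℕ.+ 1) - + (h ℕ.+ h)
  y<0 : y ℤ.< 0ℤ
  y<0 = ℤP.≰⇒> (λ 0≤y → ℕP.<⇒≱ (2j+1<m+m j<h) (ℤP.drop‿+≤+ (ℤP.0≤i-j⇒j≤i 0≤y)))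
  shifted : shiftAway n y ≡ + (2 * j ℕ.+ 1) - + (n ℕ.+ (h ℕ.+ h))
  shifted = trans (shiftAway-neg y<0) (+a-+b-+c (2 * j ℕ.+ 1) (h ℕ.+ h) n)
... | no j≮h with ℕP.m≤n⇒∃[o]m+o≡n (ℕP.≮⇒≥ j≮h)
...   | t , refl with t <? n
...     | yes t<n = inj₁ (t , t<n , +a-+b≡+c-+d (2 * (h ℕ.+ t) ℕ.+ 1) (n ℕ.+ (h ℕ.+ h)) (2 * t ℕ.+ 1) n (reindex t n h))
  where
  reindex : ∀ t n h → 2 * (h ℕ.+ t) ℕ.+ 1 ℕ.+ n ≡ 2 * t ℕ.+ 1 ℕ.+ (n ℕ.+ (h ℕ.+ h))
  reindex = ℕSolver.solve-∀
...     | no t≮n with ℕP.m≤n⇒∃[o]m+o≡n (ℕP.≮⇒≥ t≮n)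
...       | r , refl = inj₂ (y , (h ℕ.+ r , ℕP.+-monoʳ-< h r<h , refl) , shifted)
  where
  y = + (2 * (h ℕ.+ r) ℕ.+ 1) - + (h ℕ.+ h)
  r<h : r < h
  r<h = ℕP.+-cancelˡ-< (h ℕ.+ n) r h (subst₂ _<_ (sym (ℕP.+-assoc h n r)) (rearrange n h) j<N)
    where
    rearrange : ∀ n h → n ℕ.+ (h ℕ.+ h) ≡ h ℕ.+ n ℕ.+ h
    rearrange = ℕSolver.solve-∀
  0≤y : 0ℤ ℤ.≤ y
  0≤y = ℤP.i≤j⇒0≤j-i (ℤ.+≤+ (subst (h ℕ.+ h ≤_) (expand h r) (ℕP.m≤m+n (h ℕ.+ h) (2 * r ℕ.+ 1))))
    where
    expand : ∀ h r → h ℕ.+ h ℕ.+ (2 * r ℕ.+ 1) ≡ 2 * (h ℕ.+ r) ℕ.+ 1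
    expand = ℕSolver.solve-∀
  shifted : shiftAway n y ≡ + (2 * (h ℕ.+ (n ℕ.+ r)) ℕ.+ 1) - + (n ℕ.+ (h ℕ.+ h))
  shifted = begin
    shiftAway n y                                        ≡⟨ shiftAway-nonneg 0≤y ⟩
    y + + n                                              ≡⟨ +a-+b++c (2 * (h ℕ.+ r) ℕ.+ 1) (h ℕ.+ h) n ⟩
    + (2 * (h ℕ.+ r) ℕ.+ 1 ℕ.+ n) - + (h ℕ.+ h)
      ≡⟨ +a-+b≡+c-+d _ (h ℕ.+ h) (2 * (h ℕ.+ (n ℕ.+ r)) ℕ.+ 1) (n ℕ.+ (h ℕ.+ h)) (reindex h r n) ⟩
    + (2 * (h ℕ.+ (n ℕ.+ r)) ℕ.+ 1) - + (n ℕ.+ (h ℕ.+ h)) ∎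
    where
    reindex : ∀ h r n → 2 * (h ℕ.+ r) ℕ.+ 1 ℕ.+ n ℕ.+ (n ℕ.+ (h ℕ.+ h))
                        ≡ 2 * (h ℕ.+ (n ℕ.+ r)) ℕ.+ 1 ℕ.+ (h ℕ.+ h)
    reindex = ℕSolver.solve-∀

InI-avoids-shiftAway : ∀ {n x} → InI n x → ∀ y → x ≢ shiftAway n y
InI-avoids-shiftAway x∈I y = shiftAway-avoids y (proj₁ (InI-bounds x∈I)) (proj₂ (InI-bounds x∈I))

InI+shiftAway≢0 : ∀ {n x} → InI n x → ∀ y → x + shiftAway n y ≢ 0ℤ
InI+shiftAway≢0 {n} {x} x∈I y eq = InI-avoids-shiftAway (InI-neg x∈I) y (sym (inverseʳ-unique x (shiftAway n y) eq))

shiftAway-magic : ∀ {m} {adj : Adj m} {ℓ : Fin m → ℤ} n → IsBalanced adj (λ w → inA (ℓ w))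
  → (∀ a → sumOver (adj a) ℓ ≡ 0ℤ) → ∀ a → sumOver (adj a) (λ b → shiftAway n (ℓ b)) ≡ 0ℤ
shiftAway-magic {adj = adj} {ℓ} n balanced magic a = begin
  sumOver (adj a) (λ b → shiftAway n (ℓ b))
    ≡⟨ sumOver-cong (λ _ → refl) (λ b → split (ℓ b)) ⟩
  sumOver (adj a) (λ b → ℓ b + (if inA (ℓ b) then + n else - + n))
    ≡⟨ sumOver-+ (adj a) ℓ _ ⟩
  sumOver (adj a) ℓ + sumOver (adj a) (λ b → if inA (ℓ b) then + n else - + n)
    ≡⟨ cong₂ _+_ (magic a) (balanced-signed-sum {adj = adj} balanced a (+ n)) ⟩
  0ℤ ∎
  where
  split : ∀ y → shiftAway n y ≡ y + (if inA y then + n else - + n)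
  split y with inA y
  ... | true  = refl
  ... | false = refl

-- The merge

module _ {m₁ m₂ D} {adj : Adj m₁} {w₁ : Fin (suc D) → Fin m₁} {w₂ : Fin (suc D) → Fin m₂}
         (adj-sym : ∀ a b → adj a b ≡ adj b a) (cyclet : IsCyclet adj w₁)
         (w₂-injective : ∀ i j → w₂ i ≡ w₂ j → i ≡ j) (2<d : 2 < suc D) where

  cycEdge⇒adj : ∀ a b → cycEdge w₁ a b ≡ true → adj a b ≡ true
  cycEdge⇒adj a b e with crossEdge-sound w₁ w₁ e
  ... | forward i  = proj₂ cyclet i
  ... | backward i = trans (adj-sym (w₁ (sucF i)) (w₁ i)) (proj₂ cyclet i)

  rewired-sum : (f : Fin m₁ → ℤ) (g : Fin m₂ → ℤ) → (∀ a → sumOver (adj a) f ≡ 0ℤ)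
    → (∀ i → f (w₁ (sucF i)) + f (w₁ (predF i)) ≡ g (w₂ (sucF i)) + g (w₂ (predF i)))
    → ∀ a → sumOver (λ a' → adj a a' ∧ not (cycEdge w₁ a a')) f + sumOver (crossEdge w₁ w₂ a) g ≡ 0ℤ
  rewired-sum f g magic matching a = begin
    sumOver (λ a' → adj a a' ∧ not (cycEdge w₁ a a')) f + sumOver (crossEdge w₁ w₂ a) g
      ≡⟨ cong (_+ sumOver (crossEdge w₁ w₂ a) g) (sumOver-∧-not (adj a) (cycEdge w₁ a) f (cycEdge⇒adj a)) ⟩
    sumOver (adj a) f - sumOver (cycEdge w₁ a) f + sumOver (crossEdge w₁ w₂ a) g
      ≡⟨ cong₂ (λ s t → s - t + sumOver (crossEdge w₁ w₂ a) g) (magic a) cut≡added ⟩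
    0ℤ - sumOver (crossEdge w₁ w₂ a) g + sumOver (crossEdge w₁ w₂ a) g
      ≡⟨ cancel (sumOver (crossEdge w₁ w₂ a) g) ⟩
    0ℤ ∎
    where
    cancel : ∀ x → 0ℤ - x + x ≡ 0ℤ
    cancel = solve-∀
    cut≡added : sumOver (cycEdge w₁ a) f ≡ sumOver (crossEdge w₁ w₂ a) g
    cut≡added with any? (λ i → w₁ i Fin.≟ a)
    ... | yes (i , refl) = begin
      sumOver (cycEdge w₁ (w₁ i)) f         ≡⟨ sumOver-crossEdge-on w₁ w₁ (proj₁ cyclet) (proj₁ cyclet) 2<d i f ⟩
      f (w₁ (sucF i)) + f (w₁ (predF i))    ≡⟨ matching i ⟩
      g (w₂ (sucF i)) + g (w₂ (predF i))    ≡⟨ sumOver-crossEdge-on w₁ w₂ (proj₁ cyclet) w₂-injective 2<d i g ⟨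
      sumOver (crossEdge w₁ w₂ (w₁ i)) g    ∎
    ... | no off = trans (sumOver-crossEdge-off w₁ w₁ off′ f) (sym (sumOver-crossEdge-off w₁ w₂ off′ g))
      where
      off′ : ∀ i → w₁ i ≢ a
      off′ i eq = off (i , eq)

data SplitView (n : ℕ) {n' : ℕ} : Fin (n ℕ.+ n') → Set where
  left  : ∀ a → SplitView n (a ↑ˡ n')
  right : ∀ b → SplitView n (n ↑ʳ b)

splitView : ∀ n {n'} (x : Fin (n ℕ.+ n')) → SplitView n x
splitView n x with splitAt n x in eq
... | inj₁ a = subst (SplitView n) (splitAt⁻¹-↑ˡ eq) (left a)
... | inj₂ b = subst (SplitView n) (splitAt⁻¹-↑ʳ eq) (right b)

module _ {n n'} (ℓ : Fin n → ℤ) (ℓ' : Fin n' → ℤ) where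

  private
    L : Fin (n ℕ.+ n') → ℤ
    L = mergeLabel n ℓ ℓ'

  mergeLabel-↑ˡ : ∀ a → L (a ↑ˡ n') ≡ ℓ a
  mergeLabel-↑ˡ a rewrite splitAt-↑ˡ n a n' = refl

  mergeLabel-↑ʳ : ∀ b → L (n ↑ʳ b) ≡ shiftAway n (ℓ' b)
  mergeLabel-↑ʳ b rewrite splitAt-↑ʳ n n' b = refl

  mergeLabel-isBijI : ∀ h → n' ≡ h ℕ.+ h → IsBijI n ℓ → IsBijI n' ℓ' → IsBijI (n ℕ.+ n') L
  mergeLabel-isBijI h n'≡h+h (ℓ-InI , ℓ-injective , ℓ-surjective) (ℓ'-InI , ℓ'-injective , ℓ'-surjective) =
    L-InI , L-injective , L-surjective
    where
    L-InI : ∀ x → InI (n ℕ.+ n') (L x)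
    L-InI x with splitView n x
    ... | left a  = subst₂ (λ k → InI (n ℕ.+ k)) (sym n'≡h+h) (sym (mergeLabel-↑ˡ a)) (InI-widen h (ℓ-InI a))
    ... | right b = subst (InI (n ℕ.+ n')) (sym (mergeLabel-↑ʳ b)) (InI-shiftAway n (ℓ'-InI b))

    L-injective : ∀ x y → L x ≡ L y → x ≡ y
    L-injective x y eq with splitView n x | splitView n y
    ... | left a  | left a'  =
      cong (_↑ˡ n') (ℓ-injective a a' (trans (sym (mergeLabel-↑ˡ a)) (trans eq (mergeLabel-↑ˡ a'))))
    ... | right b | right b' =
      cong (n ↑ʳ_) (ℓ'-injective b b'
        (shiftAway-injective (trans (sym (mergeLabel-↑ʳ b)) (trans eq (mergeLabel-↑ʳ b')))))
    ... | left a  | right b  =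
      ⊥-elim (InI-avoids-shiftAway (ℓ-InI a) (ℓ' b) (trans (sym (mergeLabel-↑ˡ a)) (trans eq (mergeLabel-↑ʳ b))))
    ... | right b | left a   =
      ⊥-elim (InI-avoids-shiftAway (ℓ-InI a) (ℓ' b) (trans (sym (mergeLabel-↑ˡ a)) (trans (sym eq) (mergeLabel-↑ʳ b))))

    L-surjective : ∀ x → InI (n ℕ.+ n') x → ∃ λ z → L z ≡ x
    L-surjective x x∈I with InI-merge n h (subst (λ k → InI (n ℕ.+ k) x) n'≡h+h x∈I)
    ... | inj₁ x∈Iₙ = let a , ℓa≡x = ℓ-surjective x x∈Iₙ in a ↑ˡ n' , trans (mergeLabel-↑ˡ a) ℓa≡x
    ... | inj₂ (y , y∈I , shift≡x) =
      let b , ℓ'b≡y = ℓ'-surjective y (subst (λ k → InI k y) (sym n'≡h+h) y∈I)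
      in n ↑ʳ b , trans (mergeLabel-↑ʳ b) (trans (cong (shiftAway n) ℓ'b≡y) shift≡x)

  data MergedRev : Fin (n ℕ.+ n') → Fin (n ℕ.+ n') → Set where
    left  : ∀ {a a*} → IsRev ℓ a a* → MergedRev (a ↑ˡ n') (a* ↑ˡ n')
    right : ∀ {b b*} → IsRev ℓ' b b* → MergedRev (n ↑ʳ b) (n ↑ʳ b*)

  mergeLabel-rev : .{{_ : NonZero n}} → (∀ a → InI n (ℓ a)) → ∀ {x z} → IsRev L x z → MergedRev x z
  mergeLabel-rev ℓ-InI {x} {z} rev with splitView n x | splitView n z
  ... | left a  | left a*  = left (trans (sym (cong₂ _+_ (mergeLabel-↑ˡ a) (mergeLabel-↑ˡ a*))) rev)
  ... | right b | right b* =
    right (shiftAway-+≡0 {y = ℓ' b} {ℓ' b*} (trans (sym (cong₂ _+_ (mergeLabel-↑ʳ b) (mergeLabel-↑ʳ b*))) rev))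
  ... | left a  | right b  =
    ⊥-elim (InI+shiftAway≢0 (ℓ-InI a) (ℓ' b) (trans (sym (cong₂ _+_ (mergeLabel-↑ˡ a) (mergeLabel-↑ʳ b))) rev))
  ... | right b | left a   = ⊥-elim (InI+shiftAway≢0 (ℓ-InI a) (ℓ' b)
    (trans (ℤP.+-comm (ℓ a) _) (trans (sym (cong₂ _+_ (mergeLabel-↑ʳ b) (mergeLabel-↑ˡ a))) rev)))

module _ {n n' D} (adj : Adj n) (adj' : Adj n') (u : Fin (suc D) → Fin n) (v : Fin (suc D) → Fin n') where

  private
    M : Adj (n ℕ.+ n')
    M = merge adj adj' u v

  merge-↑ˡ-↑ˡ : ∀ a a' → M (a ↑ˡ n') (a' ↑ˡ n') ≡ adj a a' ∧ not (cycEdge u a a')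
  merge-↑ˡ-↑ˡ a a' rewrite splitAt-↑ˡ n a n' | splitAt-↑ˡ n a' n' = refl

  merge-↑ˡ-↑ʳ : ∀ a b → M (a ↑ˡ n') (n ↑ʳ b) ≡ crossEdge u v a b
  merge-↑ˡ-↑ʳ a b rewrite splitAt-↑ˡ n a n' | splitAt-↑ʳ n n' b = refl

  merge-↑ʳ-↑ˡ : ∀ b a → M (n ↑ʳ b) (a ↑ˡ n') ≡ crossEdge u v a b
  merge-↑ʳ-↑ˡ b a rewrite splitAt-↑ˡ n a n' | splitAt-↑ʳ n n' b = refl

  merge-↑ʳ-↑ʳ : ∀ b b' → M (n ↑ʳ b) (n ↑ʳ b') ≡ adj' b b' ∧ not (cycEdge v b b')
  merge-↑ʳ-↑ʳ b b' rewrite splitAt-↑ʳ n n' b | splitAt-↑ʳ n n' b' = refl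

  module _ {ℓ : Fin n → ℤ} {ℓ' : Fin n' → ℤ} where

    private
      L : Fin (n ℕ.+ n') → ℤ
      L = mergeLabel n ℓ ℓ'
      L' : Fin n' → ℤ
      L' b = shiftAway n (ℓ' b)

    merge-magic : (∀ a b → adj a b ≡ adj b a) → (∀ a b → adj' a b ≡ adj' b a)
      → IsCyclet adj u → IsCyclet adj' v → 2 < suc D
      → (∀ a → sumOver (adj a) ℓ ≡ 0ℤ) → (∀ b → sumOver (adj' b) L' ≡ 0ℤ)
      → (∀ i → ℓ (u (sucF i)) + ℓ (u (predF i)) ≡ L' (v (sucF i)) + L' (v (predF i)))
      → ∀ x → sumOver (M x) L ≡ 0ℤ
    merge-magic adj-sym adj'-sym cyclet cyclet' 2<d magic magic' matching x with splitView n x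
    ... | left a = begin
      sumOver (M (a ↑ˡ n')) L
        ≡⟨ sumℤ-↑ n (restrict (M (a ↑ˡ n')) L) ⟩
      sumOver (λ a' → M (a ↑ˡ n') (a' ↑ˡ n')) (λ a' → L (a' ↑ˡ n'))
        + sumOver (λ b → M (a ↑ˡ n') (n ↑ʳ b)) (λ b → L (n ↑ʳ b))
        ≡⟨ cong₂ _+_ (sumOver-cong (merge-↑ˡ-↑ˡ a) (mergeLabel-↑ˡ ℓ ℓ'))
                     (sumOver-cong (merge-↑ˡ-↑ʳ a) (mergeLabel-↑ʳ ℓ ℓ')) ⟩
      sumOver (λ a' → adj a a' ∧ not (cycEdge u a a')) ℓ + sumOver (crossEdge u v a) L'
        ≡⟨ rewired-sum adj-sym cyclet (proj₁ cyclet') 2<d ℓ L' magic matching a ⟩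
      0ℤ ∎
    ... | right b = begin
      sumOver (M (n ↑ʳ b)) L
        ≡⟨ sumℤ-↑ n (restrict (M (n ↑ʳ b)) L) ⟩
      sumOver (λ a → M (n ↑ʳ b) (a ↑ˡ n')) (λ a → L (a ↑ˡ n'))
        + sumOver (λ b' → M (n ↑ʳ b) (n ↑ʳ b')) (λ b' → L (n ↑ʳ b'))
        ≡⟨ cong₂ _+_ (sumOver-cong (λ a → trans (merge-↑ʳ-↑ˡ b a) (crossEdge-swap u v a b))
                                   (mergeLabel-↑ˡ ℓ ℓ'))
                     (sumOver-cong (merge-↑ʳ-↑ʳ b) (mergeLabel-↑ʳ ℓ ℓ')) ⟩
      sumOver (crossEdge v u b) ℓ + sumOver (λ b' → adj' b b' ∧ not (cycEdge v b b')) L'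
        ≡⟨ ℤP.+-comm (sumOver (crossEdge v u b) ℓ) _ ⟩
      sumOver (λ b' → adj' b b' ∧ not (cycEdge v b b')) L' + sumOver (crossEdge v u b) ℓ
        ≡⟨ rewired-sum adj'-sym cyclet' (proj₁ cyclet) 2<d L' ℓ magic' (sym ∘ matching) b ⟩
      0ℤ ∎

    merge-selfReverse : IsSelfReverse adj ℓ → IsSelfReverse adj' ℓ'
      → (∀ a → InI n (ℓ a)) → (∀ a b → ℓ a ≡ ℓ b → a ≡ b) → (∀ a b → ℓ' a ≡ ℓ' b → a ≡ b)
      → {σ : Fin (suc D) → Fin (suc D)} → PreservesAdjacency σ → IsRevAlong ℓ u σ → IsRevAlong ℓ' v σ
      → IsSelfReverse M L
    merge-selfReverse sr sr' ℓ-InI ℓ-injective ℓ'-injective σ-adjacency u-rev v-rev x y x* y* rx ry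
      with mergeLabel-rev ℓ ℓ' {{nonZeroIndex (u Fin.zero)}} ℓ-InI rx
         | mergeLabel-rev ℓ ℓ' {{nonZeroIndex (u Fin.zero)}} ℓ-InI ry
    ... | left {a} {a*} ra | left {b} {b*} rb = begin
      M (a ↑ˡ n') (b ↑ˡ n')                ≡⟨ merge-↑ˡ-↑ˡ a b ⟩
      adj a b ∧ not (cycEdge u a b)        ≡⟨ cong₂ (λ e c → e ∧ not c) (sr a b a* b* ra rb)
                                                (crossEdge-reverse ℓ-injective ℓ-injective σ-adjacency u-rev u-rev ra rb) ⟩
      adj a* b* ∧ not (cycEdge u a* b*)    ≡⟨ merge-↑ˡ-↑ˡ a* b* ⟨
      M (a* ↑ˡ n') (b* ↑ˡ n')              ∎
    ... | left {a} {a*} ra | right {b} {b*} rb = begin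
      M (a ↑ˡ n') (n ↑ʳ b)                 ≡⟨ merge-↑ˡ-↑ʳ a b ⟩
      crossEdge u v a b                    ≡⟨ crossEdge-reverse ℓ-injective ℓ'-injective σ-adjacency u-rev v-rev ra rb ⟩
      crossEdge u v a* b*                  ≡⟨ merge-↑ˡ-↑ʳ a* b* ⟨
      M (a* ↑ˡ n') (n ↑ʳ b*)               ∎
    ... | right {a} {a*} ra | left {b} {b*} rb = begin
      M (n ↑ʳ a) (b ↑ˡ n')                 ≡⟨ merge-↑ʳ-↑ˡ a b ⟩
      crossEdge u v b a                    ≡⟨ crossEdge-reverse ℓ-injective ℓ'-injective σ-adjacency u-rev v-rev rb ra ⟩
      crossEdge u v b* a*                  ≡⟨ merge-↑ʳ-↑ˡ a* b* ⟨
      M (n ↑ʳ a*) (b* ↑ˡ n')               ∎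
    ... | right {a} {a*} ra | right {b} {b*} rb = begin
      M (n ↑ʳ a) (n ↑ʳ b)                  ≡⟨ merge-↑ʳ-↑ʳ a b ⟩
      adj' a b ∧ not (cycEdge v a b)       ≡⟨ cong₂ (λ e c → e ∧ not c) (sr' a b a* b* ra rb)
                                                (crossEdge-reverse ℓ'-injective ℓ'-injective σ-adjacency v-rev v-rev ra rb) ⟩
      adj' a* b* ∧ not (cycEdge v a* b*)   ≡⟨ merge-↑ʳ-↑ʳ a* b* ⟨
      M (n ↑ʳ a*) (n ↑ʳ b*)                ∎

merge-isSelfReverseDML : ∀ {n n' D r} .{{_ : NonZero r}} (adj : Adj n) (adj' : Adj n')
  → (∀ a b → adj a b ≡ adj b a) → (∀ a b → adj' a b ≡ adj' b a) → IsRegular adj' r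
  → (ℓ : Fin n → ℤ) (ℓ' : Fin n' → ℤ) → IsSelfReverseDML adj ℓ → IsSelfReverseDML adj' ℓ'
  → (u : Fin (suc D) → Fin n) (v : Fin (suc D) → Fin n') → IsCyclet adj u → IsCyclet adj' v → 2 < suc D
  → IsBalanced adj' (λ w → inA (ℓ' w)) → IsAlternating (λ w → inA (ℓ' w)) v
  → (∀ i → ℓ (u (predF i)) + ℓ (u (sucF i)) ≡ ℓ' (v (predF i)) + ℓ' (v (sucF i)))
  → {σ : Fin (suc D) → Fin (suc D)} → PreservesAdjacency σ → IsRevAlong ℓ u σ → IsRevAlong ℓ' v σ
  → IsSelfReverseDML (merge adj adj' u v) (mergeLabel n ℓ ℓ')
merge-isSelfReverseDML {n} {n'} adj adj' adj-sym adj'-sym regular' ℓ ℓ'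
  ((ℓ-bij , magic) , sr) ((ℓ'-bij , magic') , sr') u v cyclet cyclet' 2<d balanced alternating sums
  σ-adjacency u-rev v-rev =
  ( mergeLabel-isBijI ℓ ℓ' (count A') n'-even ℓ-bij ℓ'-bij
  , merge-magic adj adj' u v adj-sym adj'-sym cyclet cyclet' 2<d
                magic (shiftAway-magic {adj = adj'} n balanced magic') matching )
  , merge-selfReverse adj adj' u v sr sr' (proj₁ ℓ-bij) (proj₁ (proj₂ ℓ-bij)) (proj₁ (proj₂ ℓ'-bij))
                      σ-adjacency u-rev v-rev
  where
  A' : Fin n' → Bool
  A' w = inA (ℓ' w)
  n'-even : n' ≡ count A' ℕ.+ count A'
  n'-even = trans (sym (count-not A'))
                  (cong (count A' ℕ.+_) (sym (balanced-halves adj' A' adj'-sym regular' balanced)))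
  matching : ∀ i → ℓ (u (sucF i)) + ℓ (u (predF i))
                   ≡ shiftAway n (ℓ' (v (sucF i))) + shiftAway n (ℓ' (v (predF i)))
  matching i = begin
    ℓ (u (sucF i)) + ℓ (u (predF i))     ≡⟨ ℤP.+-comm (ℓ (u (sucF i))) (ℓ (u (predF i))) ⟩
    ℓ (u (predF i)) + ℓ (u (sucF i))     ≡⟨ sums i ⟩
    ℓ' (v (predF i)) + ℓ' (v (sucF i))   ≡⟨ ℤP.+-comm (ℓ' (v (predF i))) (ℓ' (v (sucF i))) ⟩
    ℓ' (v (sucF i)) + ℓ' (v (predF i))
      ≡⟨ shiftAway-opposite {n} {ℓ' (v (sucF i))} {ℓ' (v (predF i))}
           (alternating-opposite {s = A'} {v} alternating i) ⟨
    shiftAway n (ℓ' (v (sucF i))) + shiftAway n (ℓ' (v (predF i))) ∎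

-- In case (ii) the reversal moves position i to (d₀ − 1 − i) + d₀; this is read off the
-- hypothesis at the position d₀ − 1 − i, since i ↦ d₀ − 1 − i is an involution.
cyclet-reversal : ∀ {n n' D} (ℓ : Fin n → ℤ) (ℓ' : Fin n' → ℤ)
  (u : Fin (suc D) → Fin n) (v : Fin (suc D) → Fin n') d₀
  → (∀ i → IsRev ℓ (u i) (u (addF i d₀)) × IsRev ℓ' (v i) (v (addF i d₀)))
    ⊎ (∀ i → IsRev ℓ (u (reflectF (d₀ ∸ 1) i)) (u (addF i d₀)) × IsRev ℓ' (v (reflectF (d₀ ∸ 1) i)) (v (addF i d₀)))
  → ∃ λ σ → PreservesAdjacency σ × IsRevAlong ℓ u σ × IsRevAlong ℓ' v σ
cyclet-reversal ℓ ℓ' u v d₀ (inj₁ translation) =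
  (λ i → addF i d₀) , addF-preservesAdjacency d₀ , proj₁ ∘ translation , proj₂ ∘ translation
cyclet-reversal {D = D} ℓ ℓ' u v d₀ (inj₂ reflection) =
  (λ i → addF (reflectF c i) d₀) , reflectF-preservesAdjacency c d₀ ,
  reflected ℓ u (proj₁ ∘ reflection) , reflected ℓ' v (proj₂ ∘ reflection)
  where
  c = d₀ ∸ 1
  reflected : ∀ {m} (ℓ : Fin m → ℤ) (w : Fin (suc D) → Fin m)
    → (∀ i → IsRev ℓ (w (reflectF c i)) (w (addF i d₀))) → IsRevAlong ℓ w (λ i → addF (reflectF c i) d₀)
  reflected ℓ w h i =
    subst (λ j → IsRev ℓ (w j) (w (addF (reflectF c i) d₀))) (reflectF-involutive c i) (h (reflectF c i))

corollary5p3 : (k n n' d₀ : ℕ) → 2 ≤ k → 2 ≤ d₀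
    → (adj : Adj n) (adj' : Adj n') → IsSimple adj → IsSimple adj'
    → IsRegular adj (2 * k) → IsRegular adj' (2 * k)
    → (ℓ : Fin n → ℤ) (ℓ' : Fin n' → ℤ)
    → IsSelfReverseDML adj ℓ → IsSelfReverseDML adj' ℓ'
    → (u : Fin (2 * d₀) → Fin n) (v : Fin (2 * d₀) → Fin n')
    → IsCyclet adj u → IsCyclet adj' v
    → IsBalanced adj' (λ w → inA (ℓ' w))
    → IsAlternating (λ w → inA (ℓ' w)) v
    → (∀ i → ℓ (u (predF i)) + ℓ (u (sucF i)) ≡ ℓ' (v (predF i)) + ℓ' (v (sucF i)))
    → ((∀ i → IsRev ℓ (u i) (u (addF i d₀)) × IsRev ℓ' (v i) (v (addF i d₀)))
       ⊎ (∀ i → IsRev ℓ (u (addF (negF i) (d₀ ∸ 1))) (u (addF i d₀))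
                × IsRev ℓ' (v (addF (negF i) (d₀ ∸ 1))) (v (addF i d₀))))
    → IsSelfReverseDML (merge adj adj' u v) (mergeLabel n ℓ ℓ')
corollary5p3 k n n' d₀ (s≤s (s≤s _)) 2≤d₀@(s≤s (s≤s _)) adj adj' simple simple' _ regular' ℓ ℓ' dml dml'
             u v cyclet cyclet' balanced alternating sums reversal =
  let _ , σ-adjacency , u-rev , v-rev = cyclet-reversal ℓ ℓ' u v d₀ reversal
  in merge-isSelfReverseDML adj adj' (proj₁ simple) (proj₁ simple') regular' ℓ ℓ' dml dml'
       u v cyclet cyclet' 2<d balanced alternating sums σ-adjacency u-rev v-rev
  where
  2<d : 2 < 2 * d₀
  2<d = ℕP.<-≤-trans (s≤s (s≤s (s≤s z≤n))) (ℕP.*-monoʳ-≤ 2 2≤d₀)
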